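{- Let $k$ be a positive integer. Every alternation of length at least $2k^4$ contains either a parallel alternation or a wedge alternation of length at least $2k$.
   Context: A permutation $\pi$ contains $\sigma$ if $\pi$ has a subsequence order isomorphic to $\sigma$. A horizontal alternation is a permutation in which every entry with odd value lies to the left of every entry with even value, or the reverse of such a permutation. A vertical alternation is the (group-theoretic) inverse of a horizontal alternation; equivalently, a permutation in which the entries in odd positions are all smaller than the entries in even positions, or all larger. An alternation is a horizontal or a vertical alternation. A vertical alternation is a parallel alternation if the subsequence of entries in odd positions and the subsequence of entries in even positions are both increasing or both decreasing, and a wedge alternation if one of these two subsequences is increasing and the other decreasing; a horizontal alternation is parallel (resp. wedge) if its inverse is. -}

module Defs where

open import Data.Nat using (ℕ; _%_)
open import Data.Fin using (Fin; toℕ; _<_)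
open import Data.Product using (Σ; Σ-syntax; _×_; _,_; proj₁)
open import Data.Sum using (_⊎_)
open import Function using (flip)
open import Function.Definitions using (Injective)
open import Relation.Binary.PropositionalEquality using (_≡_)

-- Positions and values are
-- 0-indexed internally; the paper's 1-indexed position/value is toℕ + 1.
Perm : ℕ → Set
Perm n = Σ[ f ∈ (Fin n → Fin n) ] Injective _≡_ _≡_ f

-- The graph of a permutation: Graph π i v  means  π(i) = v.
-- Working with graphs lets us take inverses by flipping the arguments.
Graph : ∀ {n} → Perm n → Fin n → Fin n → Set
Graph π i v = proj₁ π i ≡ v

-- "odd"/"even" in the paper's 1-indexed sense.
Odd1 : ∀ {n} → Fin n → Set
Odd1 x = toℕ x % 2 ≡ 0

Even1 : ∀ {n} → Fin n → Set
Even1 x = toℕ x % 2 ≡ 1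

Rel : ℕ → Set₁
Rel n = Fin n → Fin n → Set

HorizG : ∀ {n} → Rel n → Set
HorizG {n} G =
    (∀ (i j v w : Fin n) → G i v → G j w → Odd1 v → Even1 w → i < j)
  ⊎ (∀ (i j v w : Fin n) → G i v → G j w → Odd1 v → Even1 w → j < i)

VertG : ∀ {n} → Rel n → Set
VertG G = HorizG (flip G)

IncOn : ∀ {n} → Rel n → (Fin n → Set) → Set
IncOn {n} G P = ∀ (i j v w : Fin n) → G i v → G j w → P i → P j → i < j → v < w

DecOn : ∀ {n} → Rel n → (Fin n → Set) → Set
DecOn {n} G P = ∀ (i j v w : Fin n) → G i v → G j w → P i → P j → i < j → w < v

ParShape : ∀ {n} → Rel n → Set
ParShape G = (IncOn G Odd1 × IncOn G Even1) ⊎ (DecOn G Odd1 × DecOn G Even1)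

WedgeShape : ∀ {n} → Rel n → Set
WedgeShape G = (IncOn G Odd1 × DecOn G Even1) ⊎ (DecOn G Odd1 × IncOn G Even1)

Alternation : ∀ {n} → Perm n → Set
Alternation π = HorizG (Graph π) ⊎ VertG (Graph π)

-- A vertical alternation is parallel if its odd/even-position subsequences
-- are both increasing or both decreasing; a horizontal one is parallel iff its
-- inverse is (the inverse of a horizontal alternation is vertical).
ParallelAlternation : ∀ {n} → Perm n → Set
ParallelAlternation π =
    (VertG (Graph π) × ParShape (Graph π))
  ⊎ (HorizG (Graph π) × ParShape (flip (Graph π)))

WedgeAlternation : ∀ {n} → Perm n → Set
WedgeAlternation π =
    (VertG (Graph π) × WedgeShape (Graph π))
  ⊎ (HorizG (Graph π) × WedgeShape (flip (Graph π)))

Contains : ∀ {n m} → Perm n → Perm m → Set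
Contains {n} {m} π σ =
  Σ[ e ∈ (Fin m → Fin n) ]
    ((∀ (i j : Fin m) → i < j → e i < e j)
    × (∀ (i j : Fin m) → (proj₁ σ i < proj₁ σ j → proj₁ π (e i) < proj₁ π (e j))
                       × (proj₁ π (e i) < proj₁ π (e j) → proj₁ σ i < proj₁ σ j)))

{-# OPTIONS --safe #-}
-- A vertical alternation of length n ≥ 2k⁴ has k⁴ consecutive pairs of
-- positions (2j, 2j + 1). Comparing two pairs entrywise relates their indices by
-- one of four transitive relations (each column increasing or decreasing). If
-- none of them had a chain of k indices, the vector of longest-chain heights in
-- the four relations would label the k⁴ indices injectively by words in
-- {0, …, k − 2}⁴, which is impossible. The 2k entries of a chain of k pairs
-- form a vertical alternation with monotone columns: a parallel or wedge
-- alternation. Horizontal alternations are handled by inverting.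
module Submission where

module Orders where

  open import Data.Nat as ℕ using (ℕ; suc; _*_; _+_; _%_)
  import Data.Nat.Properties as ℕ
  open import Data.Nat.DivMod using ([m+kn]%n≡m%n; m<n⇒m%n≡m)
  open import Data.Fin using (Fin; toℕ; combine; opposite; _<_; _<?_)
  open import Data.Fin.Properties
    using (<-cmp; <-asym; <-trans; toℕ<n; toℕ-combine; combine-monoˡ-<; combine-remQuot; opposite-prop)
  open import Data.Product using (_×_; _,_; ∃-syntax)
  open import Data.Sum using (_⊎_; inj₁; inj₂)
  open import Relation.Binary.Definitions using (tri<; tri≈; tri>)
  open import Relation.Nullary using (Dec; contradiction)
  open import Relation.Binary.PropositionalEquality

  data Direction : Set where
    ↑ ↓ : Direction

  _<[_]_ : ∀ {n} → Fin n → Direction → Fin n → Set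
  x <[ ↑ ] y = x < y
  x <[ ↓ ] y = y < x

  _<[_]?_ : ∀ {n} (x : Fin n) d y → Dec (x <[ d ] y)
  x <[ ↑ ]? y = x <? y
  x <[ ↓ ]? y = y <? x

  <[]-trans : ∀ {n} {x y z : Fin n} d → x <[ d ] y → y <[ d ] z → x <[ d ] z
  <[]-trans ↑ x<y y<z = <-trans x<y y<z
  <[]-trans ↓ y<x z<y = <-trans z<y y<x

  <[]-total : ∀ {n} {x y : Fin n} → x ≢ y → ∃[ d ] x <[ d ] y
  <[]-total {x = x} {y} x≢y with <-cmp x y
  ... | tri< x<y _ _ = ↑ , x<y
  ... | tri≈ _ x≡y _ = contradiction x≡y x≢y
  ... | tri> _ _ y<x = ↓ , y<x

  opposite-< : ∀ {n} {s t : Fin n} → s < t → opposite t < opposite s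
  opposite-< {n} {s} {t} s<t = subst₂ ℕ._<_ (sym (opposite-prop t)) (sym (opposite-prop s))
                                  (ℕ.∸-monoʳ-< (ℕ.s≤s s<t) (toℕ<n t))

  module _ {m n : ℕ} {i i′ : Fin m} {j j′ : Fin n} where

    combine-<⇒lex : combine i j < combine i′ j′ → i < i′ ⊎ (i ≡ i′ × j < j′)
    combine-<⇒lex c<c′ with <-cmp i i′
    ... | tri< i<i′ _ _ = inj₁ i<i′
    ... | tri≈ _ refl _ = inj₂ (refl , ℕ.+-cancelˡ-< (n * toℕ i) (toℕ j) (toℕ j′)
                            (subst₂ ℕ._<_ (toℕ-combine i j) (toℕ-combine i j′) c<c′))
    ... | tri> _ _ i′<i = contradiction c<c′ (<-asym (combine-monoˡ-< j′ j i′<i))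

    lex⇒combine-< : i < i′ ⊎ (i ≡ i′ × j < j′) → combine i j < combine i′ j′
    lex⇒combine-< (inj₁ i<i′) = combine-monoˡ-< j j′ i<i′
    lex⇒combine-< (inj₂ (refl , j<j′)) = subst₂ ℕ._<_ (sym (toℕ-combine i j)) (sym (toℕ-combine i j′))
                                            (ℕ.+-monoʳ-< (n * toℕ i) j<j′)

  toℕ-combine-% : ∀ {m n} (i : Fin m) (j : Fin (suc n)) → toℕ (combine i j) % suc n ≡ toℕ j
  toℕ-combine-% {n = n} i j = begin
    toℕ (combine i j) % suc n          ≡⟨ cong (_% suc n) (toℕ-combine i j) ⟩
    (suc n * toℕ i + toℕ j) % suc n    ≡⟨ cong (_% suc n) (ℕ.+-comm (suc n * toℕ i) (toℕ j)) ⟩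
    (toℕ j + suc n * toℕ i) % suc n    ≡⟨ cong (λ z → (toℕ j + z) % suc n) (ℕ.*-comm (suc n) (toℕ i)) ⟩
    (toℕ j + toℕ i * suc n) % suc n    ≡⟨ [m+kn]%n≡m%n (toℕ j) (toℕ i) (suc n) ⟩
    toℕ j % suc n                      ≡⟨ m<n⇒m%n≡m (toℕ<n j) ⟩
    toℕ j                              ∎
    where open ≡-Reasoning

  data CombineView {m n} : Fin (m * n) → Set where
    combined : (i : Fin m) (j : Fin n) → CombineView (combine i j)

  combineView : ∀ {m n} (x : Fin (m * n)) → CombineView x
  combineView {m} {n} x = subst CombineView (combine-remQuot {m} n x) (combined {m} {n} _ _)

module LongestChains where

  open import Level using (Level)
  open import Data.Nat as ℕ using (ℕ; zero; suc; _⊔_; _^_; _≤?_)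
  import Data.Nat.Properties as ℕ
  open import Data.Fin using (Fin; zero; suc; toℕ; fromℕ<; opposite; _<_; funToFin; finToFun)
  open import Data.Fin.Properties
    using (toℕ<n; toℕ-fromℕ<; fromℕ<-toℕ; any?; pigeonhole; finToFun-funToFin)
  open import Data.Product using (Σ-syntax; ∃-syntax; _×_; _,_)
  open import Data.Sum using (_⊎_; inj₁; inj₂)
  open import Function using (_∘_)
  open import Relation.Binary.Core using (Rel; _⇒_)
  open import Relation.Binary.Definitions using (Decidable; Transitive)
  open import Relation.Nullary using (¬_; yes; no; contradiction)
  open import Relation.Binary.PropositionalEquality
  open Orders using (opposite-<)

  private
    variable
      ℓ : Level
      N : ℕ

  Chain : Rel (Fin N) ℓ → ℕ → Set ℓ
  Chain {N} _≺_ len = Σ[ J ∈ (Fin len → Fin N) ] (∀ {s t} → s < t → J s ≺ J t)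

  module Height {_≺_ : Rel (Fin N) ℓ} (_≺?_ : Decidable _≺_) where

    -- heightBelow x b is the number of steps of a longest ≺-chain ending at x whose
    -- earlier elements have increasing indices below b; b is a natural number so
    -- that the recursion is structural.
    heightBelow : Fin N → (b : ℕ) → .(b ℕ.≤ N) → ℕ
    heightBelow x zero _ = 0
    heightBelow x (suc j) j<N with fromℕ< j<N ≺? x
    ... | yes _ = suc (heightBelow (fromℕ< j<N) j (ℕ.<⇒≤ j<N)) ⊔ heightBelow x j (ℕ.<⇒≤ j<N)
    ... | no _ = heightBelow x j (ℕ.<⇒≤ j<N)

    height : Fin N → ℕ
    height x = heightBelow x (toℕ x) (ℕ.<⇒≤ (toℕ<n x))

    heightBelow-fromℕ< : ∀ {j} .(j<N : j ℕ.< N) →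
                         heightBelow (fromℕ< j<N) j (ℕ.<⇒≤ j<N) ≡ height (fromℕ< j<N)
    heightBelow-fromℕ< j<N = cong-bound (sym (toℕ-fromℕ< j<N))
      where
      cong-bound : ∀ {x b b′} .{p : b ℕ.≤ N} .{p′ : b′ ℕ.≤ N} →
                   b ≡ b′ → heightBelow x b p ≡ heightBelow x b′ p′
      cong-bound refl = refl

    heightBelow-attained : ∀ x b .(b≤N : b ℕ.≤ N) →
      heightBelow x b b≤N ≡ 0 ⊎ ∃[ y ] (y ≺ x × heightBelow x b b≤N ≡ suc (height y))
    heightBelow-attained x zero _ = inj₁ refl
    heightBelow-attained x (suc j) j<N with fromℕ< j<N ≺? x
    ... | no _ = heightBelow-attained x j _
    ... | yes j≺x
      with ℕ.⊔-sel (suc (heightBelow (fromℕ< j<N) j (ℕ.<⇒≤ j<N))) (heightBelow x j (ℕ.<⇒≤ j<N))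
    ...   | inj₁ eq = inj₂ (fromℕ< j<N , j≺x , trans eq (cong suc (heightBelow-fromℕ< j<N)))
    ...   | inj₂ eq with heightBelow-attained x j (ℕ.<⇒≤ j<N)
    ...     | inj₁ eq′ = inj₁ (trans eq eq′)
    ...     | inj₂ (y , y≺x , eq′) = inj₂ (y , y≺x , trans eq eq′)

    heightBelow-≥ : ∀ {x y} b .(b≤N : b ℕ.≤ N) → y ≺ x → toℕ y ℕ.< b →
                    suc (height y) ℕ.≤ heightBelow x b b≤N
    heightBelow-≥ {x} {y} (suc j) j<N y≺x y<b with fromℕ< j<N ≺? x | ℕ.m≤n⇒m<n∨m≡n (ℕ.s≤s⁻¹ y<b)
    ... | yes _ | inj₁ y<j = ℕ.≤-trans (heightBelow-≥ j _ y≺x y<j) (ℕ.m≤n⊔m _ (heightBelow x j _))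
    ... | no _  | inj₁ y<j = heightBelow-≥ j _ y≺x y<j
    ... | yes _ | inj₂ refl =
      ℕ.≤-trans (ℕ.≤-reflexive (cong suc height-y)) (ℕ.m≤m⊔n _ (heightBelow x j _))
      where
      height-y : height y ≡ heightBelow (fromℕ< j<N) (toℕ y) (ℕ.<⇒≤ j<N)
      height-y = sym (trans (heightBelow-fromℕ< j<N) (cong height (fromℕ<-toℕ y j<N)))
    ... | no y⊀x | inj₂ refl = contradiction (subst (_≺ x) (sym (fromℕ<-toℕ y j<N)) y≺x) y⊀x

    height-mono : _≺_ ⇒ _<_ → ∀ {x y} → y ≺ x → height y ℕ.< height x
    height-mono ≺⇒< {x} y≺x = heightBelow-≥ (toℕ x) _ y≺x (≺⇒< y≺x)

    height-pred : ∀ {ℓ′} x → suc ℓ′ ℕ.≤ height x → ∃[ y ] (y ≺ x × ℓ′ ℕ.≤ height y)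
    height-pred {ℓ′} x h with heightBelow-attained x (toℕ x) (ℕ.<⇒≤ (toℕ<n x))
    ... | inj₁ eq = contradiction (subst (suc ℓ′ ℕ.≤_) eq h) λ ()
    ... | inj₂ (y , y≺x , eq) = y , y≺x , ℕ.s≤s⁻¹ (subst (suc ℓ′ ℕ.≤_) eq h)

    descent : ∀ ℓ′ x → ℓ′ ℕ.≤ height x → Fin (suc ℓ′) → Fin N
    descent ℓ′ x _ zero = x
    descent (suc ℓ′) x h (suc t) with height-pred x h
    ... | y , _ , y-high = descent ℓ′ y y-high t

    module _ (≺-trans : Transitive _≺_) where

      descent-below : ∀ ℓ′ x h t → descent ℓ′ x h (suc t) ≺ x
      descent-below (suc ℓ′) x h t with height-pred x h
      descent-below (suc ℓ′) x h zero    | y , y≺x , _ = y≺x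
      descent-below (suc ℓ′) x h (suc t) | y , y≺x , y-high = ≺-trans (descent-below ℓ′ y y-high t) y≺x

      descent-descending : ∀ ℓ′ x h {s t} → s < t → descent ℓ′ x h t ≺ descent ℓ′ x h s
      descent-descending ℓ′ x h {zero} {suc t} _ = descent-below ℓ′ x h t
      descent-descending (suc ℓ′) x h {suc s} {suc t} s<t with height-pred x h
      ... | y , _ , y-high = descent-descending ℓ′ y y-high (ℕ.s≤s⁻¹ s<t)

      chainEndingAt : ∀ {ℓ′} x → ℓ′ ℕ.≤ height x → Chain _≺_ (suc ℓ′)
      chainEndingAt x h = descent _ x h ∘ opposite , descent-descending _ x h ∘ opposite-<

  module _ {c} (R : Fin c → Rel (Fin N) ℓ) (R? : ∀ a → Decidable (R a)) where

    private
      height : Fin c → Fin N → ℕ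
      height a = Height.height (R? a)

    -- Comparable indices differ in their height for a relation relating them, so
    -- the vectors of heights label Fin N injectively.
    shortChains⇒≤ : ∀ {k} → (∀ a → R a ⇒ _<_) → (∀ {i j} → i < j → ∃[ a ] R a i j) →
                    (∀ i a → height a i ℕ.< k) → N ℕ.≤ k ^ c
    shortChains⇒≤ {k} R⇒< related short = ℕ.≮⇒≥ λ few → collision (pigeonhole few label)
      where
      label : Fin N → Fin (k ^ c)
      label i = funToFin (λ a → fromℕ< (short i a))

      label-height : ∀ i a → toℕ (finToFun (label i) a) ≡ height a i
      label-height i a = trans (cong toℕ (finToFun-funToFin _ a)) (toℕ-fromℕ< (short i a))

      collision : ¬ (∃[ i ] ∃[ j ] (i < j × label i ≡ label j))
      collision (i , j , i<j , same) with related i<j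
      ... | a , r = ℕ.<⇒≢ (Height.height-mono (R? a) (R⇒< a) r) (begin
        height a i                  ≡⟨ sym (label-height i a) ⟩
        toℕ (finToFun (label i) a)  ≡⟨ cong (λ l → toℕ (finToFun l a)) same ⟩
        toℕ (finToFun (label j) a)  ≡⟨ label-height j a ⟩
        height a j                  ∎)
        where open ≡-Reasoning

    monochromaticChain : ∀ {k} → (∀ a → Transitive (R a)) → (∀ a → R a ⇒ _<_) →
      (∀ {i j} → i < j → ∃[ a ] R a i j) → k ^ c ℕ.< N → ∃[ a ] Chain (R a) (suc k)
    monochromaticChain {k} R-trans R⇒< related few with any? (λ i → any? (λ a → k ≤? height a i))
    ... | yes (i , a , long) = a , Height.chainEndingAt (R? a) (R-trans a) i long
    ... | no ¬long = contradiction (shortChains⇒≤ R⇒< related short) (ℕ.<⇒≱ few)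
      where
      short : ∀ i a → height a i ℕ.< k
      short i a = ℕ.≰⇒> (λ long → ¬long (i , a , long))

module Patterns where

  open import Defs using (Perm)
  open import Data.Nat as ℕ using (ℕ)
  open import Data.Fin using (Fin; toℕ; fromℕ<; _<_; _<?_)
  open import Data.Fin.Properties using (<-cmp; <-irrefl; <-asym; <-trans; toℕ-fromℕ<)
  open import Data.Fin.Subset using (Subset; _∈_; _⊂_; ∣_∣)
  open import Data.Fin.Subset.Properties using (p⊂q⇒∣p∣<∣q∣; ⊆⊤; ∈⊤; ∣⊤∣≡n)
  open import Data.Vec using (tabulate)
  open import Data.Vec.Properties using (lookup∘tabulate; []=⇒lookup; lookup⇒[]=)
  open import Data.Product using (_×_; _,_; proj₁; proj₂)
  open import Function.Definitions using (Injective)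
  open import Relation.Binary.Definitions using (tri<; tri≈; tri>)
  open import Relation.Nullary using (yes; no; does; contradiction)
  open import Relation.Nullary.Decidable using (dec-true; dec-false)
  open import Data.Bool using (true)
  open import Relation.Binary.PropositionalEquality
  open Orders using (↑; ↓; _<[_]_)

  private
    variable
      m n n′ : ℕ

  Increasing : (Fin m → Fin n) → Set
  Increasing e = ∀ i j → i < j → e i < e j

  SameOrder : (Fin m → Fin n) → (Fin m → Fin n′) → Set
  SameOrder f g = ∀ i j → (f i < f j → g i < g j) × (g i < g j → f i < f j)

  SameOrder-<[] : ∀ {f : Fin m → Fin n} {g : Fin m → Fin n′} → SameOrder f g →
                  ∀ d {i j} → g i <[ d ] g j → f i <[ d ] f j
  SameOrder-<[] same ↑ {i} {j} = proj₂ (same i j)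
  SameOrder-<[] same ↓ {i} {j} = proj₂ (same j i)

  module _ {f : Fin m → Fin n} {g : Fin m → Fin n′}
           (g-injective : Injective _≡_ _≡_ g) (mono : ∀ i j → g i < g j → f i < f j) where

    mono⇒reflects : ∀ i j → f i < f j → g i < g j
    mono⇒reflects i j fi<fj with <-cmp (g i) (g j)
    ... | tri< gi<gj _ _ = gi<gj
    ... | tri≈ _ gi≡gj _ = contradiction fi<fj (<-irrefl (cong f (g-injective gi≡gj)))
    ... | tri> _ _ gj<gi = contradiction fi<fj (<-asym (mono j i gj<gi))

    mono⇒injective : Injective _≡_ _≡_ f
    mono⇒injective {i} {j} fi≡fj with <-cmp (g i) (g j)
    ... | tri< gi<gj _ _ = contradiction (mono i j gi<gj) (<-irrefl fi≡fj)
    ... | tri≈ _ gi≡gj _ = g-injective gi≡gj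
    ... | tri> _ _ gj<gi = contradiction (mono j i gj<gi) (<-irrefl (sym fi≡fj))

  Increasing⇒injective : ∀ {e : Fin m → Fin n} → Increasing e → Injective _≡_ _≡_ e
  Increasing⇒injective = mono⇒injective (λ eq → eq)

  Increasing⇒reflects : ∀ {e : Fin m → Fin n} → Increasing e → ∀ i j → e i < e j → i < j
  Increasing⇒reflects = mono⇒reflects (λ eq → eq)

  module Standardise (w : Fin m → Fin n) (w-injective : Injective _≡_ _≡_ w) where

    below : Fin m → Subset m
    below i = tabulate (λ j → does (w j <? w i))

    below⁺ : ∀ {i j} → w j < w i → j ∈ below i
    below⁺ {i} {j} wj<wi =
      lookup⇒[]= j (below i) (trans (lookup∘tabulate _ j) (dec-true (w j <? w i) wj<wi))

    below⁻ : ∀ {i j} → j ∈ below i → w j < w i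
    below⁻ {i} {j} j∈ with w j <? w i
    ... | yes wj<wi = wj<wi
    ... | no wj≮wi = contradiction (trans (sym (dec-false (w j <? w i) wj≮wi)) member) λ ()
      where
      member : does (w j <? w i) ≡ true
      member = trans (sym (lookup∘tabulate _ j)) ([]=⇒lookup j∈)

    below-⊂ : ∀ {i j} → w i < w j → below i ⊂ below j
    below-⊂ {i} wi<wj = (λ k∈ → below⁺ (<-trans (below⁻ k∈) wi<wj)) , i , below⁺ wi<wj ,
                        λ i∈ → <-irrefl refl (below⁻ i∈)

    rank : Fin m → ℕ
    rank i = ∣ below i ∣

    rank<m : ∀ i → rank i ℕ.< m
    rank<m i = subst (rank i ℕ.<_) (∣⊤∣≡n m)
                 (p⊂q⇒∣p∣<∣q∣ (⊆⊤ , i , ∈⊤ , λ i∈ → <-irrefl refl (below⁻ i∈)))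

    ranks : Fin m → Fin m
    ranks i = fromℕ< (rank<m i)

    ranks-mono : ∀ i j → w i < w j → ranks i < ranks j
    ranks-mono i j wi<wj = subst₂ ℕ._<_ (sym (toℕ-fromℕ< (rank<m i))) (sym (toℕ-fromℕ< (rank<m j)))
                             (p⊂q⇒∣p∣<∣q∣ (below-⊂ wi<wj))

    standardise : Perm m
    standardise = ranks , mono⇒injective w-injective ranks-mono

    standardise-sameOrder : SameOrder ranks w
    standardise-sameOrder i j = mono⇒reflects w-injective ranks-mono i j , ranks-mono i j

module Inverses where

  open import Defs
  open import Data.Nat as ℕ using (ℕ; suc)
  import Data.Nat.Properties as ℕ
  open import Data.Fin using (Fin; punchOut; _<_)
  open import Data.Fin.Properties using (any?; _≟_; punchOut-injective; injective⇒≤)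
  open import Data.Product as Product using (∃-syntax; _,_; proj₁; proj₂)
  open import Data.Sum as Sum using (_⊎_; inj₁; inj₂)
  open import Function using (_∘_; flip)
  open import Function.Definitions using (Injective)
  open import Relation.Binary.Core using (_⇒_)
  open import Relation.Nullary using (yes; no; contradiction)
  open import Relation.Binary.PropositionalEquality
  open Patterns using (Increasing; SameOrder; Increasing⇒reflects)

  private
    variable
      n : ℕ

  injective⇒surjective : ∀ {f : Fin n → Fin n} → Injective _≡_ _≡_ f → ∀ v → ∃[ i ] f i ≡ v
  injective⇒surjective {suc n} {f} f-injective v with any? (λ i → f i ≟ v)
  ... | yes hit = hit
  ... | no miss = contradiction (injective⇒≤ g-injective) ℕ.1+n≰n
    where
    v≢f : ∀ i → v ≢ f i
    v≢f i v≡fi = miss (i , sym v≡fi)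

    g : Fin (suc n) → Fin n
    g i = punchOut (v≢f i)

    g-injective : Injective _≡_ _≡_ g
    g-injective = f-injective ∘ punchOut-injective (v≢f _) (v≢f _)

  inverse : Perm n → Perm n
  inverse {n} (f , f-injective) = f⁻¹ , f⁻¹-injective
    where
    f⁻¹ : Fin n → Fin n
    f⁻¹ v = proj₁ (injective⇒surjective f-injective v)

    f⁻¹-injective : Injective _≡_ _≡_ f⁻¹
    f⁻¹-injective {v} {w} eq = begin
      v          ≡⟨ sym (proj₂ (injective⇒surjective f-injective v)) ⟩
      f (f⁻¹ v)  ≡⟨ cong f eq ⟩
      f (f⁻¹ w)  ≡⟨ proj₂ (injective⇒surjective f-injective w) ⟩
      w          ∎
      where open ≡-Reasoning

  inverse-right : ∀ (π : Perm n) v → proj₁ π (proj₁ (inverse π) v) ≡ v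
  inverse-right (f , f-injective) v = proj₂ (injective⇒surjective f-injective v)

  inverse-graph : ∀ (π : Perm n) → Graph (inverse π) ⇒ flip (Graph π)
  inverse-graph π refl = inverse-right π _

  module _ {G H : Rel n} (H⇒G : H ⇒ G) where

    HorizG-anti : HorizG G → HorizG H
    HorizG-anti (inj₁ left) = inj₁ λ i j v w Hiv Hjw → left i j v w (H⇒G Hiv) (H⇒G Hjw)
    HorizG-anti (inj₂ right) = inj₂ λ i j v w Hiv Hjw → right i j v w (H⇒G Hiv) (H⇒G Hjw)

    IncOn-anti : ∀ {P} → IncOn G P → IncOn H P
    IncOn-anti inc i j v w Hiv Hjw = inc i j v w (H⇒G Hiv) (H⇒G Hjw)

    DecOn-anti : ∀ {P} → DecOn G P → DecOn H P
    DecOn-anti dec i j v w Hiv Hjw = dec i j v w (H⇒G Hiv) (H⇒G Hjw)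

    ParShape-anti : ParShape G → ParShape H
    ParShape-anti = Sum.map (Product.map IncOn-anti IncOn-anti) (Product.map DecOn-anti DecOn-anti)

    WedgeShape-anti : WedgeShape G → WedgeShape H
    WedgeShape-anti = Sum.map (Product.map IncOn-anti DecOn-anti) (Product.map DecOn-anti IncOn-anti)

  module _ (σ : Perm n) where

    private
      σ⁻¹-graph : Graph (inverse σ) ⇒ flip (Graph σ)
      σ⁻¹-graph = inverse-graph σ

      σ⁻¹-graph′ : flip (Graph (inverse σ)) ⇒ Graph σ
      σ⁻¹-graph′ = inverse-graph σ

    horizontal-inverse : HorizG (Graph σ) → VertG (Graph (inverse σ))
    horizontal-inverse = HorizG-anti σ⁻¹-graph′

    parallel-inverse : ParallelAlternation σ → ParallelAlternation (inverse σ)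
    parallel-inverse (inj₁ (vert , par)) =
      inj₂ (HorizG-anti σ⁻¹-graph vert , ParShape-anti σ⁻¹-graph′ par)
    parallel-inverse (inj₂ (horiz , par)) =
      inj₁ (HorizG-anti σ⁻¹-graph′ horiz , ParShape-anti σ⁻¹-graph par)

    wedge-inverse : WedgeAlternation σ → WedgeAlternation (inverse σ)
    wedge-inverse (inj₁ (vert , wedge)) =
      inj₂ (HorizG-anti σ⁻¹-graph vert , WedgeShape-anti σ⁻¹-graph′ wedge)
    wedge-inverse (inj₂ (horiz , wedge)) =
      inj₁ (HorizG-anti σ⁻¹-graph′ horiz , WedgeShape-anti σ⁻¹-graph wedge)

    alternation-inverse : ParallelAlternation σ ⊎ WedgeAlternation σ →
                          ParallelAlternation (inverse σ) ⊎ WedgeAlternation (inverse σ)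
    alternation-inverse (inj₁ parallel) = inj₁ (parallel-inverse parallel)
    alternation-inverse (inj₂ wedge) = inj₂ (wedge-inverse wedge)

  contains-inverse : ∀ {m} {π : Perm n} {σ : Perm m} → Contains (inverse π) σ → Contains π (inverse σ)
  contains-inverse {n} {m} {π} {σ} (e , e-increasing , e-sameOrder) = e′ , e′-increasing , e′-sameOrder
    where
    σ⁻¹ : Fin m → Fin m
    σ⁻¹ = proj₁ (inverse σ)

    e′ : Fin m → Fin n
    e′ a = proj₁ (inverse π) (e (σ⁻¹ a))

    π∘e′ : ∀ a → proj₁ π (e′ a) ≡ e (σ⁻¹ a)
    π∘e′ a = inverse-right π (e (σ⁻¹ a))

    e′-increasing : Increasing e′
    e′-increasing a b a<b = proj₁ (e-sameOrder (σ⁻¹ a) (σ⁻¹ b))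
      (subst₂ _<_ (sym (inverse-right σ a)) (sym (inverse-right σ b)) a<b)

    e′-sameOrder : SameOrder σ⁻¹ (proj₁ π ∘ e′)
    e′-sameOrder a b =
      (λ lt → subst₂ _<_ (sym (π∘e′ a)) (sym (π∘e′ b)) (e-increasing _ _ lt)) ,
      (λ lt → Increasing⇒reflects e-increasing _ _ (subst₂ _<_ (π∘e′ a) (π∘e′ b) lt))

module VerticalAlternations where

  open import Defs
  open import Data.Nat as ℕ using (ℕ; suc; _^_; _%_)
  import Data.Nat.Properties as ℕ
  open import Data.Fin using (Fin; toℕ; combine; remQuot; inject≤; _<_; _<?_)
  open import Data.Fin.Patterns using (0F; 1F; 2F; 3F)
  open import Data.Fin.Properties
    using (<-trans; <-irrefl; <⇒≢; toℕ-injective; toℕ-inject≤; inject≤-injective;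
           combine-injectiveˡ; remQuot-combine)
  open import Data.Product as Product using (Σ-syntax; ∃-syntax; _×_; _,_; proj₁; proj₂; uncurry)
  open import Data.Sum as Sum using (_⊎_; inj₁; inj₂)
  open import Function using (_∘_)
  open import Function.Definitions using (Injective)
  open import Relation.Binary.Definitions using (Decidable; Transitive)
  open import Relation.Nullary using (contradiction)
  open import Relation.Nullary.Decidable using (_×-dec_)
  open import Relation.Binary.PropositionalEquality
  open Orders
  open LongestChains using (Chain; monochromaticChain)
  open Patterns

  private
    variable
      m n : ℕ

  Separated : Direction → (Fin m → Fin n) → Set
  Separated d f = ∀ v w → Odd1 v → Even1 w → f v <[ d ] f w

  OrderedOn : Direction → (Fin m → Fin n) → (Fin m → Set) → Set
  OrderedOn d f P = ∀ i j → P i → P j → i < j → f i <[ d ] f j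

  MonoOn : Direction → Rel n → (Fin n → Set) → Set
  MonoOn ↑ = IncOn
  MonoOn ↓ = DecOn

  VertG⇒Separated : ∀ (π : Perm n) → VertG (Graph π) → ∃[ d ] Separated d (proj₁ π)
  VertG⇒Separated π (inj₁ below) = ↑ , λ v w → below _ _ v w refl refl
  VertG⇒Separated π (inj₂ above) = ↓ , λ v w → above _ _ v w refl refl

  Separated⇒VertG : ∀ (π : Perm n) d → Separated d (proj₁ π) → VertG (Graph π)
  Separated⇒VertG π ↑ sep = inj₁ λ { _ _ v w refl refl → sep v w }
  Separated⇒VertG π ↓ sep = inj₂ λ { _ _ v w refl refl → sep v w }

  OrderedOn⇒MonoOn : ∀ (π : Perm n) {P} d → OrderedOn d (proj₁ π) P → MonoOn d (Graph π) P
  OrderedOn⇒MonoOn π ↑ ord = λ { i j _ _ refl refl → ord i j }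
  OrderedOn⇒MonoOn π ↓ ord = λ { i j _ _ refl refl → ord i j }

  SameOrder-Separated : ∀ {n′} {f : Fin m → Fin n} {g : Fin m → Fin n′} {d} →
                        SameOrder f g → Separated d g → Separated d f
  SameOrder-Separated {d = d} same sep v w odd even = SameOrder-<[] same d (sep v w odd even)

  SameOrder-OrderedOn : ∀ {n′} {f : Fin m → Fin n} {g : Fin m → Fin n′} {d P} →
                        SameOrder f g → OrderedOn d g P → OrderedOn d f P
  SameOrder-OrderedOn {d = d} same ord i j pi pj i<j = SameOrder-<[] same d (ord i j pi pj i<j)

  verticalAlternation : ∀ (σ : Perm n) dp dq → VertG (Graph σ) →
    MonoOn dp (Graph σ) Odd1 → MonoOn dq (Graph σ) Even1 → ParallelAlternation σ ⊎ WedgeAlternation σ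
  verticalAlternation σ ↑ ↑ vert odd even = inj₁ (inj₁ (vert , inj₁ (odd , even)))
  verticalAlternation σ ↓ ↓ vert odd even = inj₁ (inj₁ (vert , inj₂ (odd , even)))
  verticalAlternation σ ↑ ↓ vert odd even = inj₂ (inj₁ (vert , inj₁ (odd , even)))
  verticalAlternation σ ↓ ↑ vert odd even = inj₂ (inj₁ (vert , inj₂ (odd , even)))

  pairsFit : ∀ K {n} → 2 ℕ.* K ℕ.≤ n → K ℕ.* 2 ℕ.≤ n
  pairsFit K {n} = subst (ℕ._≤ n) (ℕ.*-comm 2 K)

  module Columns {n K} (π : Perm n) (K*2≤n : K ℕ.* 2 ℕ.≤ n) where

    pairPos : Fin K → Fin 2 → Fin n
    pairPos j b = inject≤ (combine j b) K*2≤n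

    column : Fin 2 → Fin K → Fin n
    column b j = proj₁ π (pairPos j b)

    pairPos-parity : ∀ j b → toℕ (pairPos j b) % 2 ≡ toℕ b
    pairPos-parity j b = trans (cong (_% 2) (toℕ-inject≤ (combine j b) K*2≤n)) (toℕ-combine-% j b)

    pairPos-< : ∀ {j j′ b b′} → j < j′ ⊎ (j ≡ j′ × b < b′) → pairPos j b < pairPos j′ b′
    pairPos-< lex =
      subst₂ ℕ._<_ (sym (toℕ-inject≤ _ K*2≤n)) (sym (toℕ-inject≤ _ K*2≤n)) (lex⇒combine-< lex)

    column-injective : ∀ b → Injective _≡_ _≡_ (column b)
    column-injective b eq = combine-injectiveˡ _ b _ b (inject≤-injective _ _ _ _ (proj₂ π eq))

    _≺[_]_ : Fin K → Direction × Direction → Fin K → Set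
    i ≺[ d ] j = i < j × column 0F i <[ proj₁ d ] column 0F j × column 1F i <[ proj₂ d ] column 1F j

    ≺-dec : ∀ d → Decidable _≺[ d ]_
    ≺-dec d i j = (i <? j) ×-dec ((column 0F i <[ proj₁ d ]? column 0F j) ×-dec
                                  (column 1F i <[ proj₂ d ]? column 1F j))

    ≺-trans : ∀ d → Transitive _≺[ d ]_
    ≺-trans (dp , dq) (i<j , p , q) (j<k , p′ , q′) =
      <-trans i<j j<k , <[]-trans dp p p′ , <[]-trans dq q q′

    directions : Fin 4 → Direction × Direction
    directions 0F = ↑ , ↑
    directions 1F = ↑ , ↓
    directions 2F = ↓ , ↑
    directions 3F = ↓ , ↓

    comparable : ∀ {i j} → i < j → ∃[ a ] i ≺[ directions a ] j
    comparable {i} {j} i<j with <[]-total (distinct 0F) | <[]-total (distinct 1F)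
      where
      distinct : ∀ b → column b i ≢ column b j
      distinct b = <⇒≢ i<j ∘ column-injective b
    ... | ↑ , p | ↑ , q = 0F , i<j , p , q
    ... | ↑ , p | ↓ , q = 1F , i<j , p , q
    ... | ↓ , p | ↑ , q = 2F , i<j , p , q
    ... | ↓ , p | ↓ , q = 3F , i<j , p , q

    longChain : ∀ {k} → k ^ 4 ℕ.< K → ∃[ a ] Chain _≺[ directions a ]_ (suc k)
    longChain = monochromaticChain (λ a → _≺[ directions a ]_) (≺-dec ∘ directions)
                                   (≺-trans ∘ directions) (λ _ → proj₁) comparable

    module ChainPattern {k} (a : Fin 4) (J : Fin (suc k) → Fin K)
                        (J-chain : ∀ {s t} → s < t → J s ≺[ directions a ] J t) where

      embedding : Fin (suc k ℕ.* 2) → Fin n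
      embedding = uncurry (λ t b → pairPos (J t) b) ∘ remQuot 2

      embedding-combine : ∀ t b → embedding (combine t b) ≡ pairPos (J t) b
      embedding-combine t b = cong (uncurry (λ t b → pairPos (J t) b)) (remQuot-combine t b)

      embedding-increasing : Increasing embedding
      embedding-increasing x y x<y with combineView {suc k} x | combineView {suc k} y
      ... | combined t b | combined t′ b′ =
        subst₂ _<_ (sym (embedding-combine t b)) (sym (embedding-combine t′ b′))
          (pairPos-< (Sum.map (proj₁ ∘ J-chain) (Product.map₁ (cong J)) (combine-<⇒lex x<y)))

      embedding-parity : ∀ x → toℕ (embedding x) % 2 ≡ toℕ x % 2
      embedding-parity x with combineView {suc k} x
      ... | combined t b = begin
        toℕ (embedding (combine t b)) % 2  ≡⟨ cong (λ y → toℕ y % 2) (embedding-combine t b) ⟩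
        toℕ (pairPos (J t) b) % 2          ≡⟨ pairPos-parity (J t) b ⟩
        toℕ b                              ≡⟨ toℕ-combine-% t b ⟨
        toℕ (combine t b) % 2              ∎
        where open ≡-Reasoning

      parityClass-ordered : ∀ b {d} → (∀ {s t} → s < t → column b (J s) <[ d ] column b (J t)) →
                         OrderedOn d (proj₁ π ∘ embedding) (λ x → toℕ x % 2 ≡ toℕ b)
      parityClass-ordered b {d} ordered x y x≡b y≡b x<y
        with combineView {suc k} x | combineView {suc k} y
      ... | combined t b₁ | combined t′ b₂
        with toℕ-injective (trans (sym (toℕ-combine-% t b₁)) x≡b)
           | toℕ-injective (trans (sym (toℕ-combine-% t′ b₂)) y≡b)
      ... | refl | refl =
        subst₂ (λ u v → u <[ d ] v)
          (cong (proj₁ π) (sym (embedding-combine t b))) (cong (proj₁ π) (sym (embedding-combine t′ b)))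
          (ordered (same-column (combine-<⇒lex x<y)))
        where
        same-column : t < t′ ⊎ (t ≡ t′ × b < b) → t < t′
        same-column (inj₁ t<t′) = t<t′
        same-column (inj₂ (_ , b<b)) = contradiction b<b (<-irrefl refl)

      private
        module S = Standardise (proj₁ π ∘ embedding)
                               (λ eq → Increasing⇒injective embedding-increasing (proj₂ π eq))

      chainPattern : Perm (suc k ℕ.* 2)
      chainPattern = S.standardise

      chainPattern-contained : Contains π chainPattern
      chainPattern-contained = embedding , embedding-increasing , S.standardise-sameOrder

      chainPattern-alternation : ∀ {V} → Separated V (proj₁ π) →
                                 ParallelAlternation chainPattern ⊎ WedgeAlternation chainPattern
      chainPattern-alternation {V} separated =
        verticalAlternation chainPattern dp dq vertical
          (OrderedOn⇒MonoOn chainPattern dp odd-ordered) (OrderedOn⇒MonoOn chainPattern dq even-ordered)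
        where
        dp dq : Direction
        dp = proj₁ (directions a)
        dq = proj₂ (directions a)

        vertical : VertG (Graph chainPattern)
        vertical = Separated⇒VertG chainPattern V (SameOrder-Separated S.standardise-sameOrder
          λ v w odd even → separated (embedding v) (embedding w)
                                     (trans (embedding-parity v) odd) (trans (embedding-parity w) even))

        odd-ordered : OrderedOn dp (proj₁ chainPattern) Odd1
        odd-ordered = SameOrder-OrderedOn S.standardise-sameOrder
                        (parityClass-ordered 0F (λ s<t → proj₁ (proj₂ (J-chain s<t))))

        even-ordered : OrderedOn dq (proj₁ chainPattern) Even1
        even-ordered = SameOrder-OrderedOn S.standardise-sameOrder
                         (parityClass-ordered 1F (λ s<t → proj₂ (proj₂ (J-chain s<t))))

  verticalCase : ∀ k {n} → 2 ℕ.* suc k ^ 4 ℕ.≤ n → (π : Perm n) → VertG (Graph π) →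
    Σ[ m ∈ ℕ ] Σ[ σ ∈ Perm m ]
      (2 ℕ.* suc k ℕ.≤ m × (ParallelAlternation σ ⊎ WedgeAlternation σ) × Contains π σ)
  verticalCase k {n} long π vertical =
    suc k ℕ.* 2 , chainPattern , ℕ.≤-reflexive (ℕ.*-comm 2 (suc k)) ,
    chainPattern-alternation (proj₂ (VertG⇒Separated π vertical)) , chainPattern-contained
    where
    open Columns {K = suc k ^ 4} π (pairsFit (suc k ^ 4) long)

    chain : ∃[ a ] Chain _≺[ directions a ]_ (suc k)
    chain = longChain (ℕ.^-monoˡ-< 4 (ℕ.n<1+n k))

    open ChainPattern (proj₁ chain) (proj₁ (proj₂ chain)) (proj₂ (proj₂ chain))

open import Defs
open import Data.Nat using (ℕ; suc; _*_; _^_; _≤_; _<_)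
open import Data.Product using (Σ-syntax; _×_; _,_)
open import Data.Sum using (_⊎_; inj₁; inj₂)
open Inverses using (inverse; horizontal-inverse; alternation-inverse; contains-inverse)
open VerticalAlternations using (verticalCase)

proposition4p1 : (k : ℕ) → 0 < k → (n : ℕ) → 2 * k ^ 4 ≤ n → (π : Perm n) → Alternation π →
    Σ[ m ∈ ℕ ] Σ[ σ ∈ Perm m ] (2 * k ≤ m × (ParallelAlternation σ ⊎ WedgeAlternation σ) × Contains π σ)
proposition4p1 (suc k) _ _ long π (inj₂ vertical) = verticalCase k long π vertical
proposition4p1 (suc k) _ _ long π (inj₁ horizontal) =
  let m , σ , length , alternation , σ⊆π⁻¹ =
        verticalCase k long (inverse π) (horizontal-inverse π horizontal)
  in m , inverse σ , length , alternation-inverse σ alternation , contains-inverse σ⊆π⁻¹
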